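{- For every $n\geq 4$ and all positive integers $p,q,r$ with $p+q+r+1=n$, there are two quasimetric spaces $\mathcal{Q}_1$ and $\mathcal{Q}_2$ of size $n$ whose betweennesses are not isomorphic, such that for each $i\in\{1,2\}$, $\mathcal{L}_{\mathcal{Q}_i}=\{\ell_1,\ell_2,\ell_3,\ell_4\}$ with $|\ell_1|=n-1$, $|\ell_2|=p+1$, $|\ell_3|=q+1$ and $|\ell_4|=r+1$.
   Context: A quasimetric space is a pair $(Q,\rho)$ where $Q$ is a set and $\rho:Q\times Q\to[0,\infty)$ satisfies $\rho(x,y)=0\iff x=y$ and $\rho(x,y)\le \rho(x,z)+\rho(z,y)$ for all $x,y,z\in Q$ ($\rho$ need not be symmetric); its size is $|Q|$. For $a,b\in Q$ let $[ab]=\{c\in Q:\rho(a,b)=\rho(a,c)+\rho(c,b)\}$. For distinct $a,b\in Q$, the line $\overrightarrow{ab}=\{c\in Q: a\in[cb]\ \text{or}\ c\in[ab]\ \text{or}\ b\in[ac]\}$. $\mathcal{L}_\mathcal{Q}$ is the set of all lines $\overrightarrow{ab}$ with $a\neq b$. The betweenness of $\mathcal{Q}$ is the set of ordered triples $(a,b,c)$ of pairwise distinct points with $\rho(a,b)+\rho(b,c)=\rho(a,c)$. Betweennesses on point sets $Q,P$ are isomorphic if there is a bijection $\varphi:Q\to P$ mapping triples in one to triples in the other, i.e. $(a,b,c)\in\mathcal{B}_\mathcal{Q}\iff(\varphi(a),\varphi(b),\varphi(c))\in\mathcal{B}_\mathcal{P}$. -}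

module Defs where

open import Data.Nat using (ℕ)
open import Data.Fin using (Fin)
open import Data.Fin.Subset using (Subset)
open import Data.Vec using (tabulate)
open import Data.Rational using (ℚ; 0ℚ; _+_; _≤_; _≟_)
open import Data.Product using (Σ; _×_; _,_)
open import Data.Sum using (_⊎_)
open import Relation.Nullary using (¬_; Dec; yes; no; does)
open import Relation.Nullary.Decidable using (_⊎-dec_)
open import Relation.Binary.PropositionalEquality using (_≡_; _≢_)
open import Function.Bundles using (_⇔_; _⤖_; Bijection)

record QuasiMetric (n : ℕ) : Set where
  field
    ρ        : Fin n → Fin n → ℚ
    nonneg   : ∀ x y → 0ℚ ≤ ρ x y
    zero⇔eq  : ∀ x y → (ρ x y ≡ 0ℚ) ⇔ (x ≡ y)
    triangle : ∀ x y z → ρ x y ≤ ρ x z + ρ z y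

module _ {n : ℕ} (Q : QuasiMetric n) where
  open QuasiMetric Q

  InSeg : Fin n → Fin n → Fin n → Set
  InSeg a b c = ρ a b ≡ ρ a c + ρ c b

  inSeg? : ∀ a b c → Dec (InSeg a b c)
  inSeg? a b c = ρ a b ≟ ρ a c + ρ c b

  OnLine : Fin n → Fin n → Fin n → Set
  OnLine a b c = InSeg c b a ⊎ InSeg a b c ⊎ InSeg a c b

  onLine? : ∀ a b c → Dec (OnLine a b c)
  onLine? a b c = inSeg? c b a ⊎-dec (inSeg? a b c ⊎-dec inSeg? a c b)

  line : Fin n → Fin n → Subset n
  line a b = tabulate (λ c → does (onLine? a b c))

  IsLine : Subset n → Set
  IsLine ℓ = Σ (Fin n) λ a → Σ (Fin n) λ b → a ≢ b × line a b ≡ ℓ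

  Betw : Fin n → Fin n → Fin n → Set
  Betw a b c = a ≢ b × b ≢ c × a ≢ c × ρ a b + ρ b c ≡ ρ a c

BetweennessIso : ∀ {n} → QuasiMetric n → QuasiMetric n → Set
BetweennessIso {n} Q P =
  Σ (Fin n ⤖ Fin n) λ φ → let f = Bijection.to φ in
    ∀ a b c → (Betw Q a b c ⇔ Betw P (f a) (f b) (f c))

-- The points are 0, 1, …, n − 1, split into the blocks O = {0}, A, B, C of sizes 1, p, q, r.
-- The distance from x to y is M·λ(x, y) + δ(x, y) with M = 3n, where the level λ depends only
-- on the blocks of x and y and δ is ±(y − x), its sign depending on the blocks and the order of
-- x and y. Since |δ| < n, an equation ρ(x, z) = ρ(x, y) + ρ(y, z) holds exactly when it holds
-- separately for the levels and for the δ's, and for three distinct points the latter forces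
-- all three signs to agree. Consequently every question about segments, lines and betweenness
-- depends only on the blocks and relative order of the points involved, and is settled by
-- evaluating finitely many cases. The lines turn out to be ℓ_O = Q ∖ {0} and ℓ_K = {0} ∪ K for
-- K = A, B, C. The two spaces differ only in the level λ(C, A), which is 1 or 2: with 1, any
-- a ∈ A, b ∈ B, c ∈ C form a cyclic betweenness (a, b, c), (b, c, a), (c, a, b); with 2 no
-- cyclic triple exists, and an isomorphism of betweennesses would transport one.
module Submission where

open import Data.Bool using (Bool; true; false; T; not; _∧_; _∨_; if_then_else_)
open import Data.Bool.Properties using (T-∧; T-∨; T-≡; ∧-zeroʳ) renaming (_≟_ to _≟ᵇ_)
open import Data.Empty using (⊥-elim)
open import Data.Fin using (Fin; toℕ; fromℕ<)
open import Data.Fin.Properties using (toℕ<n; toℕ-injective; toℕ-fromℕ<)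
open import Data.Fin.Subset using (Subset; ∣_∣)
open import Data.Integer as ℤ using (ℤ; +_; +≤+)
import Data.Integer.Properties as ℤ
import Data.Integer.Tactic.RingSolver as ℤ-Ring
open import Data.Nat
open import Data.Nat.DivMod using (_%_; m<n⇒m%n≡m; [m+kn]%n≡m%n)
open import Data.Nat.Properties
open import Data.Nat.Tactic.RingSolver using (solve-∀)
open import Data.Product using (Σ; _×_; _,_; proj₁; proj₂)
open import Data.Rational as ℚ using (ℚ; 0ℚ; ↥_; *≤*)
open import Data.Rational.Literals using (fromℤ)
open import Data.Rational.Properties using (toℚᵘ-injective; toℚᵘ-homo-+)
import Data.Rational.Unnormalised as ℚᵘ
import Data.Rational.Unnormalised.Properties as ℚᵘ
open import Data.Sum using (_⊎_; inj₁; inj₂)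
open import Data.Sum.Function.Propositional using (_⊎-⇔_)
open import Data.Unit using (tt)
open import Data.Vec using (tabulate; lookup)
open import Data.Vec.Properties using (tabulate-cong; lookup∘tabulate)
open import Function using (_∘_)
open import Function.Bundles using (_⇔_; mk⇔; Equivalence; Bijection)
open import Function.Properties.Equivalence using ()
  renaming (refl to ⇔-refl; sym to ⇔-sym; trans to ⇔-trans)
open import Relation.Binary.Definitions using (DecidableEquality; tri<; tri≈; tri>)
open import Relation.Binary.PropositionalEquality
open import Relation.Nullary using (¬_; Dec; yes; no)
open import Relation.Nullary.Decidable using (⌊_⌋; _×-dec_; toWitness; fromWitness; does-⇔; T?)

open import Defs

_⇒ᵇ_ : Bool → Bool → Bool
x ⇒ᵇ y = not x ∨ y

∧-intro : ∀ {x y} → T x → T y → T (x ∧ y)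
∧-intro p q = Equivalence.from T-∧ (p , q)

∧-elimˡ : ∀ x {y} → T (x ∧ y) → T x
∧-elimˡ true _ = tt

∧-elimʳ : ∀ x {y} → T (x ∧ y) → T y
∧-elimʳ true p = p

⇒ᵇ-elim : ∀ x {y} → T (x ⇒ᵇ y) → T x → T y
⇒ᵇ-elim true p _ = p

T-not : ∀ x → T (not x) → ¬ T x
T-not false _ ()

data Comparison : Set where
  less equal greater : Comparison

converse : Comparison → Comparison
converse less    = greater
converse equal   = equal
converse greater = less

apart : Comparison → Bool
apart equal = false
apart _     = true

agree : Comparison → Comparison → Bool
agree less    less    = true
agree equal   equal   = true
agree greater greater = true
agree _       _       = false

cmp : ℕ → ℕ → Comparison
cmp zero    zero    = equal
cmp zero    (suc _) = less
cmp (suc _) zero    = greater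
cmp (suc x) (suc y) = cmp x y

cmp-less : ∀ x y → cmp x y ≡ less → x < y
cmp-less zero    (suc y) _ = z<s
cmp-less (suc x) (suc y) e = s<s (cmp-less x y e)

cmp-greater : ∀ x y → cmp x y ≡ greater → y < x
cmp-greater (suc x) zero    _ = z<s
cmp-greater (suc x) (suc y) e = s<s (cmp-greater x y e)

cmp-equal : ∀ x y → cmp x y ≡ equal → x ≡ y
cmp-equal zero    zero    _ = refl
cmp-equal (suc x) (suc y) e = cong suc (cmp-equal x y e)

cmp-self : ∀ x → cmp x x ≡ equal
cmp-self zero    = refl
cmp-self (suc x) = cmp-self x

cmp-converse : ∀ x y → cmp y x ≡ converse (cmp x y)
cmp-converse zero    zero    = refl
cmp-converse zero    (suc y) = refl
cmp-converse (suc x) zero    = refl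
cmp-converse (suc x) (suc y) = cmp-converse x y

<⇒cmp-less : ∀ {x y} → x < y → cmp x y ≡ less
<⇒cmp-less {zero}  {suc y} _         = refl
<⇒cmp-less {suc x} {suc y} (s<s x<y) = <⇒cmp-less x<y

≢⇒apart : ∀ {x y} → x ≢ y → apart (cmp x y) ≡ true
≢⇒apart {x} {y} x≢y with cmp x y in e
... | less    = refl
... | greater = refl
... | equal   = ⊥-elim (x≢y (cmp-equal x y e))

cmp-less⇒≢ : ∀ {k} {x y : Fin k} → cmp (toℕ x) (toℕ y) ≡ less → x ≢ y
cmp-less⇒≢ {x = x} {y} e = <⇒≢ (cmp-less (toℕ x) (toℕ y) e) ∘ cong toℕ

-- The arguments are the comparisons of (x, y), (x, z) and (y, z).
transitiveᵇ : Comparison → Comparison → Comparison → Bool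
transitiveᵇ equal   o₁₃ o₂₃     = agree o₁₃ o₂₃
transitiveᵇ o₁₂     o₁₃ equal   = agree o₁₂ o₁₃
transitiveᵇ less    o₁₃ less    = agree o₁₃ less
transitiveᵇ greater o₁₃ greater = agree o₁₃ greater
transitiveᵇ _       _   _       = true

cmp-transitive : ∀ x y z → T (transitiveᵇ (cmp x y) (cmp x z) (cmp y z))
cmp-transitive zero    zero    zero    = tt
cmp-transitive zero    zero    (suc z) = tt
cmp-transitive zero    (suc y) zero    = tt
cmp-transitive zero    (suc y) (suc z) with cmp y z
... | less    = tt
... | equal   = tt
... | greater = tt
cmp-transitive (suc x) zero    zero    = tt
cmp-transitive (suc x) zero    (suc z) with cmp x z
... | less    = tt
... | equal   = tt
... | greater = tt
cmp-transitive (suc x) (suc y) zero    with cmp x y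
... | less    = tt
... | equal   = tt
... | greater = tt
cmp-transitive (suc x) (suc y) (suc z) = cmp-transitive x y z

data Direction : Set where
  forward backward : Direction

_≟ᵈ_ : DecidableEquality Direction
forward  ≟ᵈ forward  = yes refl
forward  ≟ᵈ backward = no λ ()
backward ≟ᵈ forward  = no λ ()
backward ≟ᵈ backward = yes refl

-- δ s x y = δ⁺ s x y − δ⁻ s x y is y − x going forward and x − y going backward.
δ⁺ δ⁻ : Direction → ℕ → ℕ → ℕ
δ⁺ forward  x y = y
δ⁺ backward x y = x
δ⁻ forward  x y = x
δ⁻ backward x y = y

δ⁺-self : ∀ s x → δ⁺ s x x ≡ x
δ⁺-self forward  x = refl
δ⁺-self backward x = refl

δ⁻-self : ∀ s x → δ⁻ s x x ≡ x
δ⁻-self forward  x = refl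
δ⁻-self backward x = refl

δ⁺-< : ∀ s {x y m} → x < m → y < m → δ⁺ s x y < m
δ⁺-< forward  _   y<m = y<m
δ⁺-< backward x<m _   = x<m

δ⁻-< : ∀ s {x y m} → x < m → y < m → δ⁻ s x y < m
δ⁻-< forward  x<m _   = x<m
δ⁻-< backward _   y<m = y<m

δ-additive : ∀ s x y z → δ⁺ s x z + δ⁻ s x y + δ⁻ s y z ≡ δ⁺ s x y + δ⁺ s y z + δ⁻ s x z
δ-additive forward  x y z = trans (+-comm (z + x) y) (sym (+-assoc y z x))
δ-additive backward x y z = refl

private
  double-cancel : ∀ a b c → a + a + c ≡ b + b + c → a ≡ b
  double-cancel a b c e with <-cmp a b
  ... | tri< a<b _ _ = ⊥-elim (<⇒≢ (+-monoˡ-< c (+-mono-< a<b a<b)) e)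
  ... | tri≈ _ a≡b _ = a≡b
  ... | tri> _ _ b<a = ⊥-elim (<⇒≢ (+-monoˡ-< c (+-mono-< b<a b<a)) (sym e))

  aca≡aac : ∀ a c → a + c + a ≡ a + a + c
  aca≡aac = solve-∀

  caa≡aac : ∀ a c → c + a + a ≡ a + a + c
  caa≡aac = solve-∀

δ-additive⇒aligned : ∀ s s₁ s₂ {x y z} → x ≢ y → y ≢ z → x ≢ z →
  δ⁺ s x z + δ⁻ s₁ x y + δ⁻ s₂ y z ≡ δ⁺ s₁ x y + δ⁺ s₂ y z + δ⁻ s x z → s ≡ s₁ × s ≡ s₂
δ-additive⇒aligned forward  forward  forward  _ _ _ _ = refl , refl
δ-additive⇒aligned backward backward backward _ _ _ _ = refl , refl
δ-additive⇒aligned forward  forward  backward {x} {y} {z} _ y≢z _ e =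
  ⊥-elim (y≢z (sym (double-cancel z y x (trans (sym (aca≡aac z x)) e))))
δ-additive⇒aligned forward  backward forward  {x} {y} {z} x≢y _ _ e =
  ⊥-elim (x≢y (sym (double-cancel y x z (trans (sym (caa≡aac y z)) (trans e (aca≡aac x z))))))
δ-additive⇒aligned forward  backward backward {x} {y} {z} _ _ x≢z e =
  ⊥-elim (x≢z (sym (double-cancel z x y (trans (sym (aca≡aac z y)) (trans e (aca≡aac x y))))))
δ-additive⇒aligned backward forward  forward  {x} {y} {z} _ _ x≢z e =
  ⊥-elim (x≢z (double-cancel x z y (trans e (caa≡aac z y))))
δ-additive⇒aligned backward forward  backward {x} {y} {z} x≢y _ _ e =
  ⊥-elim (x≢y (double-cancel x y z e))
δ-additive⇒aligned backward backward forward  {x} {y} {z} _ y≢z _ e =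
  ⊥-elim (y≢z (double-cancel y z x (trans (sym (caa≡aac y x)) (trans e (caa≡aac z x)))))

δ-≤ᵇ : Direction → Direction → Comparison → Bool
δ-≤ᵇ _        _        equal   = true
δ-≤ᵇ forward  forward  _       = true
δ-≤ᵇ backward backward _       = true
δ-≤ᵇ backward forward  less    = true
δ-≤ᵇ forward  backward greater = true
δ-≤ᵇ _        _        _       = false

δ-≤ : ∀ s s' x y → T (δ-≤ᵇ s s' (cmp x y)) → δ⁺ s x y + δ⁻ s' x y ≤ δ⁺ s' x y + δ⁻ s x y
δ-≤ forward  forward  x y _ = ≤-refl
δ-≤ backward backward x y _ = ≤-refl
δ-≤ forward  backward x y h with cmp x y in e
... | greater = +-mono-≤ (<⇒≤ (cmp-greater x y e)) (<⇒≤ (cmp-greater x y e))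
... | equal   = ≤-reflexive (cong₂ _+_ (sym (cmp-equal x y e)) (sym (cmp-equal x y e)))
... | less    = ⊥-elim h
δ-≤ backward forward  x y h with cmp x y in e
... | less    = +-mono-≤ (<⇒≤ (cmp-less x y e)) (<⇒≤ (cmp-less x y e))
... | equal   = ≤-reflexive (cong₂ _+_ (cmp-equal x y e) (cmp-equal x y e))
... | greater = ⊥-elim h

δ-triangle : ∀ s s₁ s₂ x y z → T (δ-≤ᵇ s s₁ (cmp x y)) → T (δ-≤ᵇ s s₂ (cmp y z)) →
  δ⁺ s x z + δ⁻ s₁ x y + δ⁻ s₂ y z ≤ δ⁺ s₁ x y + δ⁺ s₂ y z + δ⁻ s x z
δ-triangle s s₁ s₂ x y z h₁ h₂ = +-cancelʳ-≤ (d + e) (a + b + c) (i + j + h) (begin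
  a + b + c + (d + e)  ≡⟨ shuffle₁ a b c d e ⟩
  a + d + e + b + c    ≡⟨ cong (λ w → w + b + c) (δ-additive s x y z) ⟩
  f + g + h + b + c    ≡⟨ shuffle₂ f g h b c ⟩
  f + b + (g + c) + h  ≤⟨ +-monoˡ-≤ h (+-mono-≤ (δ-≤ s s₁ x y h₁) (δ-≤ s s₂ y z h₂)) ⟩
  i + d + (j + e) + h  ≡⟨ shuffle₃ i d j e h ⟩
  i + j + h + (d + e)  ∎)
  where
  open ≤-Reasoning
  a = δ⁺ s x z
  b = δ⁻ s₁ x y
  c = δ⁻ s₂ y z
  d = δ⁻ s x y
  e = δ⁻ s y z
  f = δ⁺ s x y
  g = δ⁺ s y z
  h = δ⁻ s x z
  i = δ⁺ s₁ x y
  j = δ⁺ s₂ y z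
  shuffle₁ : ∀ a b c d e → a + b + c + (d + e) ≡ a + d + e + b + c
  shuffle₁ = solve-∀
  shuffle₂ : ∀ f g h b c → f + g + h + b + c ≡ f + b + (g + c) + h
  shuffle₂ = solve-∀
  shuffle₃ : ∀ i d j e h → i + d + (j + e) + h ≡ i + j + h + (d + e)
  shuffle₃ = solve-∀

increasing : Direction → Comparison → Bool
increasing forward  less    = true
increasing backward greater = true
increasing _        _       = false

δ-increasing : ∀ s x y → T (increasing s (cmp x y)) → δ⁻ s x y < δ⁺ s x y
δ-increasing forward  x y h with cmp x y in e
... | less    = cmp-less x y e
... | equal   = ⊥-elim h
... | greater = ⊥-elim h
δ-increasing backward x y h with cmp x y in e
... | greater = cmp-greater x y e
... | less    = ⊥-elim h
... | equal   = ⊥-elim h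

+*-injective : ∀ {M a b e f} → e < M → f < M → e + a * M ≡ f + b * M → a ≡ b × e ≡ f
+*-injective {M} {a} {b} {e} {f} e<M f<M eq = a≡b , e≡f
  where
  instance
    M≢0 : NonZero M
    M≢0 = >-nonZero (≤-<-trans z≤n e<M)
  open ≡-Reasoning
  e≡f : e ≡ f
  e≡f = begin
    e                ≡⟨ m<n⇒m%n≡m e<M ⟨
    e % M            ≡⟨ [m+kn]%n≡m%n e a M ⟨
    (e + a * M) % M  ≡⟨ cong (_% M) eq ⟩
    (f + b * M) % M  ≡⟨ [m+kn]%n≡m%n f b M ⟩
    f % M            ≡⟨ m<n⇒m%n≡m f<M ⟩
    f                ∎
  a≡b : a ≡ b
  a≡b = *-cancelʳ-≡ a b M (+-cancelˡ-≡ e _ _ (trans eq (cong (_+ b * M) (sym e≡f))))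

+*-mono-< : ∀ {M a b e f} → a < b → e < M → e + a * M ≤ f + b * M
+*-mono-< {M} {a} {b} {e} {f} a<b e<M = begin
  e + a * M  ≤⟨ +-monoˡ-≤ (a * M) (<⇒≤ e<M) ⟩
  M + a * M  ≤⟨ *-monoˡ-≤ M a<b ⟩
  b * M      ≤⟨ m≤n+m (b * M) f ⟩
  f + b * M  ∎
  where open ≤-Reasoning

⟦_⊖_⟧ : ℕ → ℕ → ℚ
⟦ a ⊖ b ⟧ = fromℤ (+ a ℤ.- + b)

private
  fromℤ-injective : ∀ {i j} → fromℤ i ≡ fromℤ j → i ≡ j
  fromℤ-injective = cong ↥_

  fromℤ-+ : ∀ i j → fromℤ (i ℤ.+ j) ≡ fromℤ i ℚ.+ fromℤ j
  fromℤ-+ i j = toℚᵘ-injective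
    (ℚᵘ.≃-trans (ℚᵘ.*≡* (identity i j)) (ℚᵘ.≃-sym (toℚᵘ-homo-+ (fromℤ i) (fromℤ j))))
    where
    identity : ∀ i j → (i ℤ.+ j) ℤ.* + 1 ≡ (i ℤ.* + 1 ℤ.+ j ℤ.* + 1) ℤ.* + 1
    identity = ℤ-Ring.solve-∀

  fromℤ-mono-≤ : ∀ {i j} → i ℤ.≤ j → fromℤ i ℚ.≤ fromℤ j
  fromℤ-mono-≤ {i} {j} i≤j = *≤* (subst₂ ℤ._≤_ (sym (ℤ.*-identityʳ i)) (sym (ℤ.*-identityʳ j)) i≤j)

  module Shifted (a₁ b₁ a₂ b₂ a₃ b₃ : ℕ) where
    shift : ℤ
    shift = ℤ.- (+ b₁ ℤ.+ + b₂ ℤ.+ + b₃)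

    +-+-+ : ∀ a b c → + (a + b + c) ≡ + a ℤ.+ + b ℤ.+ + c
    +-+-+ a b c = trans (ℤ.pos-+ (a + b) c) (cong (ℤ._+ + c) (ℤ.pos-+ a b))

    lhs : + a₁ ℤ.- + b₁ ≡ + (a₁ + b₂ + b₃) ℤ.+ shift
    lhs = trans (identity (+ a₁) (+ b₁) (+ b₂) (+ b₃)) (cong (ℤ._+ shift) (sym (+-+-+ a₁ b₂ b₃)))
      where
      identity : ∀ a₁ b₁ b₂ b₃ → a₁ ℤ.- b₁ ≡ a₁ ℤ.+ b₂ ℤ.+ b₃ ℤ.+ ℤ.- (b₁ ℤ.+ b₂ ℤ.+ b₃)
      identity = ℤ-Ring.solve-∀

    rhs : (+ a₂ ℤ.- + b₂) ℤ.+ (+ a₃ ℤ.- + b₃) ≡ + (a₂ + a₃ + b₁) ℤ.+ shift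
    rhs = trans (identity (+ a₂) (+ b₂) (+ a₃) (+ b₃) (+ b₁)) (cong (ℤ._+ shift) (sym (+-+-+ a₂ a₃ b₁)))
      where
      identity : ∀ a₂ b₂ a₃ b₃ b₁ →
        (a₂ ℤ.- b₂) ℤ.+ (a₃ ℤ.- b₃) ≡ a₂ ℤ.+ a₃ ℤ.+ b₁ ℤ.+ ℤ.- (b₁ ℤ.+ b₂ ℤ.+ b₃)
      identity = ℤ-Ring.solve-∀

    unshift : ∀ {i j} → i ℤ.+ shift ≡ j ℤ.+ shift → i ≡ j
    unshift {i} {j} e = trans (identity i shift) (trans (cong (ℤ._- shift) e) (sym (identity j shift)))
      where
      identity : ∀ i s → i ≡ i ℤ.+ s ℤ.- s
      identity = ℤ-Ring.solve-∀

⟦⊖⟧-additive : ∀ a₁ b₁ a₂ b₂ a₃ b₃ →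
  (⟦ a₁ ⊖ b₁ ⟧ ≡ ⟦ a₂ ⊖ b₂ ⟧ ℚ.+ ⟦ a₃ ⊖ b₃ ⟧) ⇔ (a₁ + b₂ + b₃ ≡ a₂ + a₃ + b₁)
⟦⊖⟧-additive a₁ b₁ a₂ b₂ a₃ b₃ = mk⇔ to from
  where
  open Shifted a₁ b₁ a₂ b₂ a₃ b₃
  to : ⟦ a₁ ⊖ b₁ ⟧ ≡ ⟦ a₂ ⊖ b₂ ⟧ ℚ.+ ⟦ a₃ ⊖ b₃ ⟧ → a₁ + b₂ + b₃ ≡ a₂ + a₃ + b₁
  to e = ℤ.+-injective (unshift (trans (sym lhs) (trans ℤ-eq rhs)))
    where ℤ-eq = fromℤ-injective (trans e (sym (fromℤ-+ (+ a₂ ℤ.- + b₂) (+ a₃ ℤ.- + b₃))))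
  from : a₁ + b₂ + b₃ ≡ a₂ + a₃ + b₁ → ⟦ a₁ ⊖ b₁ ⟧ ≡ ⟦ a₂ ⊖ b₂ ⟧ ℚ.+ ⟦ a₃ ⊖ b₃ ⟧
  from e = trans (cong fromℤ (trans lhs (trans (cong (λ t → + t ℤ.+ shift) e) (sym rhs))))
                 (fromℤ-+ (+ a₂ ℤ.- + b₂) (+ a₃ ℤ.- + b₃))

⟦⊖⟧-subadditive : ∀ a₁ b₁ a₂ b₂ a₃ b₃ → a₁ + b₂ + b₃ ≤ a₂ + a₃ + b₁ →
  ⟦ a₁ ⊖ b₁ ⟧ ℚ.≤ ⟦ a₂ ⊖ b₂ ⟧ ℚ.+ ⟦ a₃ ⊖ b₃ ⟧
⟦⊖⟧-subadditive a₁ b₁ a₂ b₂ a₃ b₃ le =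
  subst (⟦ a₁ ⊖ b₁ ⟧ ℚ.≤_) (fromℤ-+ (+ a₂ ℤ.- + b₂) (+ a₃ ℤ.- + b₃))
    (fromℤ-mono-≤ (subst₂ ℤ._≤_ (sym lhs) (sym rhs) (ℤ.+-monoˡ-≤ shift (+≤+ le))))
  where open Shifted a₁ b₁ a₂ b₂ a₃ b₃

⟦⊖⟧≡0⇔ : ∀ a b → (⟦ a ⊖ b ⟧ ≡ 0ℚ) ⇔ (a ≡ b)
⟦⊖⟧≡0⇔ a b = mk⇔ to from
  where
  to : ⟦ a ⊖ b ⟧ ≡ 0ℚ → a ≡ b
  to e = ℤ.+-injective (trans (identity (+ a) (+ b)) (cong (ℤ._+ + b) (fromℤ-injective e)))
    where
    identity : ∀ a b → a ≡ (a ℤ.- b) ℤ.+ b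
    identity = ℤ-Ring.solve-∀
  from : a ≡ b → ⟦ a ⊖ b ⟧ ≡ 0ℚ
  from refl = cong fromℤ (ℤ.+-inverseʳ (+ a))

⟦⊖⟧-nonneg : ∀ {a b} → b ≤ a → 0ℚ ℚ.≤ ⟦ a ⊖ b ⟧
⟦⊖⟧-nonneg {a} {b} b≤a =
  fromℤ-mono-≤ (subst (ℤ._≤ + a ℤ.- + b) (ℤ.+-inverseʳ (+ b)) (ℤ.+-monoˡ-≤ (ℤ.- + b) (+≤+ b≤a)))

data Class : Set where
  O A B C : Class

rank : Class → ℕ
rank O = 0
rank A = 1
rank B = 2
rank C = 3

sameClass : Class → Class → Bool
sameClass k k' = rank k ≡ᵇ rank k'

data Variant : Set where
  cyclic acyclic : Variant

level : Variant → Class → Class → ℕ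
level _       O O = 0
level _       O _ = 3
level _       _ O = 3
level _       A _ = 0
level _       B A = 1
level _       B _ = 0
level cyclic  C A = 1
level acyclic C A = 2
level _       C B = 1
level _       C C = 0

level-diag : ∀ v k → level v k k ≡ 0
level-diag _ O = refl
level-diag _ A = refl
level-diag _ B = refl
level-diag _ C = refl

direction : Class → Class → Comparison → Direction
direction O _  _       = backward
direction _ O  _       = backward
direction k k' greater = if sameClass k k' then backward else forward
direction _ _  _       = forward

-- The label (as in ℓ_K) of the line through points in blocks k, k' compared by o.
lineClass : Class → Class → Comparison → Class
lineClass O k  _       = k
lineClass k O  _       = k
lineClass k k' greater = if sameClass k k' then k else O
lineClass _ _  _       = O

inLine : Class → Class → Bool
inLine O k = not (sameClass k O)
inLine t k = sameClass k O ∨ sameClass k t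

record Config : Set where
  constructor config
  field
    class₁ class₂ class₃ : Class
    cmp₁₂ cmp₁₃ cmp₂₃ : Comparison

rotate : Config → Config
rotate (config k₁ k₂ k₃ o₁₂ o₁₃ o₂₃) = config k₂ k₃ k₁ o₂₃ (converse o₁₂) (converse o₁₃)

swap₂₃ : Config → Config
swap₂₃ (config k₁ k₂ k₃ o₁₂ o₁₃ o₂₃) = config k₁ k₃ k₂ o₁₃ o₁₂ (converse o₂₃)

distinctᵇ : Config → Bool
distinctᵇ (config _ _ _ o₁₂ o₁₃ o₂₃) = apart o₁₂ ∧ apart o₁₃ ∧ apart o₂₃

-- Blocks are intervals listed in the order O, A, B, C, and O holds a single point.
pairConsistent : Class → Class → Comparison → Bool
pairConsistent k k' less    = (rank k ≤ᵇ rank k') ∧ (0 <ᵇ rank k')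
pairConsistent k k' equal   = sameClass k k'
pairConsistent k k' greater = (rank k' ≤ᵇ rank k) ∧ (0 <ᵇ rank k)

consistent : Config → Bool
consistent (config k₁ k₂ k₃ o₁₂ o₁₃ o₂₃) =
  pairConsistent k₁ k₂ o₁₂ ∧ pairConsistent k₁ k₃ o₁₃ ∧ pairConsistent k₂ k₃ o₂₃ ∧
  transitiveᵇ o₁₂ o₁₃ o₂₃

module _ (v : Variant) where

  -- For distinct points, M·λ + δ is additive along them iff λ is and the three δ's point the same way.
  Proper : Config → Set
  Proper (config k₁ k₂ k₃ o₁₂ o₁₃ o₂₃) =
    level v k₁ k₃ ≡ level v k₁ k₂ + level v k₂ k₃ ×
    direction k₁ k₃ o₁₃ ≡ direction k₁ k₂ o₁₂ × direction k₁ k₃ o₁₃ ≡ direction k₂ k₃ o₂₃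

  proper? : ∀ cf → Dec (Proper cf)
  proper? (config k₁ k₂ k₃ o₁₂ o₁₃ o₂₃) =
    (level v k₁ k₃ ≟ level v k₁ k₂ + level v k₂ k₃) ×-dec
    (direction k₁ k₃ o₁₃ ≟ᵈ direction k₁ k₂ o₁₂) ×-dec (direction k₁ k₃ o₁₃ ≟ᵈ direction k₂ k₃ o₂₃)

  -- the middle point of the configuration lies on the segment from the first to the last
  segmentᵇ : Config → Bool
  segmentᵇ cf@(config _ _ _ o₁₂ o₁₃ o₂₃) = (apart o₁₂ ∧ apart o₂₃) ⇒ᵇ (apart o₁₃ ∧ ⌊ proper? cf ⌋)

  -- the last point lies on the line through the first two
  onLineᵇ : Config → Bool
  onLineᵇ cf = segmentᵇ (rotate (rotate cf)) ∨ segmentᵇ (swap₂₃ cf) ∨ segmentᵇ cf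

  cyclicᵇ : Config → Bool
  cyclicᵇ cf = segmentᵇ cf ∧ segmentᵇ (rotate cf) ∧ segmentᵇ (rotate (rotate cf))

  cyclicᵇ-intro : ∀ cf → T (segmentᵇ cf) → T (segmentᵇ (rotate cf)) → T (segmentᵇ (rotate (rotate cf))) →
    T (cyclicᵇ cf)
  cyclicᵇ-intro cf s₁ s₂ s₃ = ∧-intro s₁ (∧-intro s₂ s₃)

  triangleᵇ : Config → Bool
  triangleᵇ (config k₁ k₂ k₃ o₁₂ o₁₃ o₂₃) =
    (level v k₁ k₃ ≤ᵇ level v k₁ k₂ + level v k₂ k₃) ∧
    (⌊ level v k₁ k₃ ≟ level v k₁ k₂ + level v k₂ k₃ ⌋ ⇒ᵇ
      (δ-≤ᵇ s₁₃ (direction k₁ k₂ o₁₂) o₁₂ ∧ δ-≤ᵇ s₁₃ (direction k₂ k₃ o₂₃) o₂₃))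
    where s₁₃ = direction k₁ k₃ o₁₃

  positiveᵇ : Class × Class × Comparison → Bool
  positiveᵇ (k , k' , o) = apart o ⇒ᵇ ((0 <ᵇ level v k k') ∨ increasing (direction k k' o) o)

  lineᵇ : Config → Bool
  lineᵇ cf@(config k₁ k₂ k₃ o₁₂ _ _) = apart o₁₂ ⇒ᵇ ⌊ onLineᵇ cf ≟ᵇ inLine (lineClass k₁ k₂ o₁₂) k₃ ⌋

-- Exhaustive verification over all configurations

record Searchable (X : Set) : Set where
  field
    ∀ᵇ      : (X → Bool) → Bool
    ∀ᵇ-elim : ∀ f → T (∀ᵇ f) → ∀ x → T (f x)

open Searchable

searchable-× : ∀ {X Y} → Searchable X → Searchable Y → Searchable (X × Y)
searchable-× SX SY = record
  { ∀ᵇ      = λ f → ∀ᵇ SX λ x → ∀ᵇ SY λ y → f (x , y)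
  ; ∀ᵇ-elim = λ f h (x , y) →
      ∀ᵇ-elim SY (λ y → f (x , y)) (∀ᵇ-elim SX (λ x → ∀ᵇ SY λ y → f (x , y)) h x) y
  }

searchable-retract : ∀ {X Y} (g : X → Y) (h : Y → X) → (∀ y → g (h y) ≡ y) →
  Searchable X → Searchable Y
searchable-retract g h gh≡id SX = record
  { ∀ᵇ      = λ f → ∀ᵇ SX (f ∘ g)
  ; ∀ᵇ-elim = λ f p y → subst (T ∘ f) (gh≡id y) (∀ᵇ-elim SX (f ∘ g) p (h y))
  }

classes : Searchable Class
classes = record { ∀ᵇ = λ f → f O ∧ f A ∧ f B ∧ f C ; ∀ᵇ-elim = elim }
  where
  elim : ∀ f → T (f O ∧ f A ∧ f B ∧ f C) → ∀ k → T (f k)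
  elim f h O = ∧-elimˡ (f O) h
  elim f h A = ∧-elimˡ (f A) (∧-elimʳ (f O) h)
  elim f h B = ∧-elimˡ (f B) (∧-elimʳ (f A) (∧-elimʳ (f O) h))
  elim f h C = ∧-elimʳ (f B) (∧-elimʳ (f A) (∧-elimʳ (f O) h))

comparisons : Searchable Comparison
comparisons = record { ∀ᵇ = λ f → f less ∧ f equal ∧ f greater ; ∀ᵇ-elim = elim }
  where
  elim : ∀ f → T (f less ∧ f equal ∧ f greater) → ∀ o → T (f o)
  elim f h less    = ∧-elimˡ (f less) h
  elim f h equal   = ∧-elimˡ (f equal) (∧-elimʳ (f less) h)
  elim f h greater = ∧-elimʳ (f equal) (∧-elimʳ (f less) h)

pairs : Searchable (Class × Class × Comparison)
pairs = searchable-× classes (searchable-× classes comparisons)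

configs : Searchable Config
configs = searchable-retract
  (λ ((k₁ , k₂ , k₃) , (o₁₂ , o₁₃ , o₂₃)) → config k₁ k₂ k₃ o₁₂ o₁₃ o₂₃)
  (λ (config k₁ k₂ k₃ o₁₂ o₁₃ o₂₃) → (k₁ , k₂ , k₃) , (o₁₂ , o₁₃ , o₂₃))
  (λ _ → refl)
  (searchable-× (searchable-× classes (searchable-× classes classes))
                (searchable-× comparisons (searchable-× comparisons comparisons)))

∀⟨_⟩_⇒_ : ∀ {X} → Searchable X → (X → Bool) → (X → Bool) → Bool
∀⟨ S ⟩ G ⇒ P = ∀ᵇ S λ x → G x ⇒ᵇ P x

∀⇒-elim : ∀ {X} (S : Searchable X) G P → T (∀⟨ S ⟩ G ⇒ P) → ∀ x → T (G x) → T (P x)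
∀⇒-elim S G P h x = ⇒ᵇ-elim (G x) (∀ᵇ-elim S (λ x → G x ⇒ᵇ P x) h x)

pairConsistentᵗ : Class × Class × Comparison → Bool
pairConsistentᵗ (k , k' , o) = pairConsistent k k' o

positivity-holds : ∀ v → T (∀⟨ pairs ⟩ pairConsistentᵗ ⇒ positiveᵇ v)
positivity-holds cyclic  = tt
positivity-holds acyclic = tt

triangle-holds : ∀ v → T (∀⟨ configs ⟩ consistent ⇒ triangleᵇ v)
triangle-holds cyclic  = tt
triangle-holds acyclic = tt

lines-hold : ∀ v → T (∀⟨ configs ⟩ consistent ⇒ lineᵇ v)
lines-hold cyclic  = tt
lines-hold acyclic = tt

acyclicᵇ : Config → Bool
acyclicᵇ cf = distinctᵇ cf ⇒ᵇ not (cyclicᵇ acyclic cf)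

acyclic-holds : T (∀⟨ configs ⟩ consistent ⇒ acyclicᵇ)
acyclic-holds = tt

countᵇ : (ℕ → Bool) → ℕ → ℕ
countᵇ f zero    = 0
countᵇ f (suc m) = (if f 0 then 1 else 0) + countᵇ (f ∘ suc) m

∣tabulate∣≡countᵇ : ∀ m f → ∣ tabulate {n = m} (f ∘ toℕ) ∣ ≡ countᵇ f m
∣tabulate∣≡countᵇ zero    f = refl
∣tabulate∣≡countᵇ (suc m) f with f 0
... | true  = cong suc (∣tabulate∣≡countᵇ m (f ∘ suc))
... | false = ∣tabulate∣≡countᵇ m (f ∘ suc)

countᵇ-+ : ∀ a b f → countᵇ f (a + b) ≡ countᵇ f a + countᵇ (λ i → f (a + i)) b
countᵇ-+ zero    b f = refl
countᵇ-+ (suc a) b f = trans (cong (λ w → (if f 0 then 1 else 0) + w) (countᵇ-+ a b (f ∘ suc)))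
                             (sym (+-assoc (if f 0 then 1 else 0) _ _))

countᵇ-const : ∀ m f b → (∀ i → i < m → f i ≡ b) → countᵇ f m ≡ (if b then m else 0)
countᵇ-const zero    f true  _ = refl
countᵇ-const zero    f false _ = refl
countᵇ-const (suc m) f b h rewrite h 0 z<s
  with b | countᵇ-const m (f ∘ suc) b (λ i i<m → h (suc i) (s<s i<m))
... | true  | IH = cong suc IH
... | false | IH = IH

block : Bool → Bool → Class
block true  _     = A
block false true  = B
block false false = C

block-nonzero : ∀ b₁ b₂ → 0 < rank (block b₁ b₂)
block-nonzero true  _     = z<s
block-nonzero false true  = z<s
block-nonzero false false = z<s

block-mono : ∀ {b₁ b₂ c₁ c₂} → (T c₁ → T b₁) → (T c₂ → T b₂) → rank (block b₁ b₂) ≤ rank (block c₁ c₂)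
block-mono {true}  {_}     {c₁}    {c₂}    _  _  = block-nonzero c₁ c₂
block-mono {false} {_}     {true}  {_}     h₁ _  = ⊥-elim (h₁ tt)
block-mono {false} {true}  {false} {true}  _  _  = ≤-refl
block-mono {false} {true}  {false} {false} _  _  = s≤s (s≤s z≤n)
block-mono {false} {false} {false} {true}  _  h₂ = ⊥-elim (h₂ tt)
block-mono {false} {false} {false} {false} _  _  = ≤-refl

<ᵇ-antitone : ∀ {x y t} → x ≤ y → T (y <ᵇ t) → T (x <ᵇ t)
<ᵇ-antitone {x} {y} {t} x≤y y<t = <⇒<ᵇ (≤-<-trans x≤y (<ᵇ⇒< y t y<t))

<ᵇ-true : ∀ {x t} → x < t → (x <ᵇ t) ≡ true
<ᵇ-true x<t = Equivalence.to T-≡ (<⇒<ᵇ x<t)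

<ᵇ-false : ∀ {x t} → t ≤ x → (x <ᵇ t) ≡ false
<ᵇ-false {x} {t} t≤x with x <ᵇ t in e
... | false = refl
... | true  = ⊥-elim (<⇒≱ (<ᵇ⇒< x t (Equivalence.from T-≡ e)) t≤x)

module Construction (p q r : ℕ) where

  n : ℕ
  n = p + q + r + 1

  classOf : ℕ → Class
  classOf zero    = O
  classOf (suc i) = block (i <ᵇ p) (i <ᵇ p + q)

  classOf-A : ∀ {i} → i < p → classOf (suc i) ≡ A
  classOf-A i<p rewrite <ᵇ-true i<p = refl

  classOf-B : ∀ {i} → p ≤ i → i < p + q → classOf (suc i) ≡ B
  classOf-B p≤i i<p+q rewrite <ᵇ-false p≤i | <ᵇ-true i<p+q = refl

  classOf-C : ∀ {i} → p + q ≤ i → classOf (suc i) ≡ C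
  classOf-C {i} p+q≤i rewrite <ᵇ-false (≤-trans (m≤m+n p q) p+q≤i) | <ᵇ-false p+q≤i = refl

  classOf-mono : ∀ {x y} → x ≤ y → rank (classOf x) ≤ rank (classOf y)
  classOf-mono {zero}          _         = z≤n
  classOf-mono {suc x} {suc y} (s≤s x≤y) =
    block-mono (<ᵇ-antitone {t = p} x≤y) (<ᵇ-antitone {t = p + q} x≤y)

  classOf-nonzero : ∀ {x y} → x < y → 0 < rank (classOf y)
  classOf-nonzero {y = suc y} _ = block-nonzero _ _

  configOf : ℕ → ℕ → ℕ → Config
  configOf x y z = config (classOf x) (classOf y) (classOf z) (cmp x y) (cmp x z) (cmp y z)

  pairConsistent-classOf : ∀ x y → T (pairConsistent (classOf x) (classOf y) (cmp x y))
  pairConsistent-classOf x y with cmp x y in e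
  ... | less    = ∧-intro (≤⇒≤ᵇ (classOf-mono (<⇒≤ x<y))) (<⇒<ᵇ (classOf-nonzero x<y))
    where x<y = cmp-less x y e
  ... | greater = ∧-intro (≤⇒≤ᵇ (classOf-mono (<⇒≤ y<x))) (<⇒<ᵇ (classOf-nonzero y<x))
    where y<x = cmp-greater x y e
  ... | equal rewrite cmp-equal x y e = ≡⇒≡ᵇ (rank (classOf y)) _ refl

  configOf-consistent : ∀ x y z → T (consistent (configOf x y z))
  configOf-consistent x y z =
    ∧-intro (pairConsistent-classOf x y) (∧-intro (pairConsistent-classOf x z)
      (∧-intro (pairConsistent-classOf y z) (cmp-transitive x y z)))

  configOf-distinct : ∀ {x y z} → x ≢ y → x ≢ z → y ≢ z → T (distinctᵇ (configOf x y z))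
  configOf-distinct x≢y x≢z y≢z rewrite ≢⇒apart x≢y | ≢⇒apart x≢z | ≢⇒apart y≢z = tt

  configOf-rotate : ∀ x y z → configOf y z x ≡ rotate (configOf x y z)
  configOf-rotate x y z = cong₂ (config _ _ _ (cmp y z)) (cmp-converse x y) (cmp-converse x z)

  configOf-rotate² : ∀ x y z → configOf z x y ≡ rotate (rotate (configOf x y z))
  configOf-rotate² x y z = trans (configOf-rotate y z x) (cong rotate (configOf-rotate x y z))

  configOf-swap : ∀ x y z → configOf x z y ≡ swap₂₃ (configOf x y z)
  configOf-swap x y z = cong (config _ _ _ (cmp x z) (cmp x y)) (cmp-converse y z)

  configOf-≡ : ∀ {x y z k₁ k₂ k₃ o₁₂ o₁₃ o₂₃} →
    classOf x ≡ k₁ → classOf y ≡ k₂ → classOf z ≡ k₃ → cmp x y ≡ o₁₂ → cmp x z ≡ o₁₃ → cmp y z ≡ o₂₃ →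
    configOf x y z ≡ config k₁ k₂ k₃ o₁₂ o₁₃ o₂₃
  configOf-≡ refl refl refl refl refl refl = refl

  verified-at : ∀ P → T (∀⟨ configs ⟩ consistent ⇒ P) → ∀ x y z → T (P (configOf x y z))
  verified-at P h x y z = ∀⇒-elim configs consistent P h (configOf x y z) (configOf-consistent x y z)

  ℓ : Class → Subset n
  ℓ t = tabulate λ c → inLine t (classOf (toℕ c))

  ∣ℓ∣ : ∀ t → ∣ ℓ t ∣ ≡ (if inLine t O then 1 else 0) + ((if inLine t A then p else 0) +
                         ((if inLine t B then q else 0) + (if inLine t C then r else 0)))
  ∣ℓ∣ t = begin
    ∣ ℓ t ∣                                           ≡⟨ ∣tabulate∣≡countᵇ n g ⟩
    countᵇ g n                                        ≡⟨ cong (countᵇ g) n≡1+p+q+r ⟩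
    countᵇ g (suc (p + (q + r)))                      ≡⟨ cong (λ w → g₀ + w) (countᵇ-+ p (q + r) gA) ⟩
    g₀ + (countᵇ gA p + countᵇ gB (q + r))            ≡⟨ cong (λ w → g₀ + (countᵇ gA p + w)) (countᵇ-+ q r gB) ⟩
    g₀ + (countᵇ gA p + (countᵇ gB q + countᵇ gC r))  ≡⟨ cong₂ (λ u w → g₀ + (u + w)) A-count
                                                                (cong₂ _+_ B-count C-count) ⟩
    _                                                 ∎
    where
    open ≡-Reasoning
    g : ℕ → Bool
    g i = inLine t (classOf i)
    g₀ = if g 0 then 1 else 0
    gA : ℕ → Bool
    gA i = g (suc i)
    gB : ℕ → Bool
    gB i = gA (p + i)
    gC : ℕ → Bool
    gC i = gB (q + i)
    n≡1+p+q+r : n ≡ suc (p + (q + r))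
    n≡1+p+q+r = trans (+-comm (p + q + r) 1) (cong suc (+-assoc p q r))
    B-block : ∀ {i} → i < q → classOf (suc (p + i)) ≡ B
    B-block i<q = classOf-B (m≤m+n p _) (+-monoʳ-< p i<q)
    C-block : ∀ i → classOf (suc (p + (q + i))) ≡ C
    C-block i = classOf-C (≤-trans (m≤m+n (p + q) i) (≤-reflexive (+-assoc p q i)))
    A-count = countᵇ-const p gA _ λ i i<p → cong (inLine t) (classOf-A i<p)
    B-count = countᵇ-const q gB _ λ i i<q → cong (inLine t) (B-block i<q)
    C-count = countᵇ-const r gC _ λ i _ → cong (inLine t) (C-block i)

  ∣ℓO∣+1≡n : ∣ ℓ O ∣ + 1 ≡ n
  ∣ℓO∣+1≡n = cong (_+ 1) (trans (∣ℓ∣ O) (sym (+-assoc p q r)))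

  ∣ℓA∣≡p+1 : ∣ ℓ A ∣ ≡ p + 1
  ∣ℓA∣≡p+1 = trans (∣ℓ∣ A) (trans (cong suc (+-identityʳ p)) (+-comm 1 p))

  ∣ℓB∣≡q+1 : ∣ ℓ B ∣ ≡ q + 1
  ∣ℓB∣≡q+1 = trans (∣ℓ∣ B) (trans (cong suc (+-identityʳ q)) (+-comm 1 q))

  ∣ℓC∣≡r+1 : ∣ ℓ C ∣ ≡ r + 1
  ∣ℓC∣≡r+1 = trans (∣ℓ∣ C) (+-comm 1 r)

  ℓ-separated : ∀ {t t' k} (c : Fin n) → classOf (toℕ c) ≡ k → inLine t k ≢ inLine t' k → ℓ t ≢ ℓ t'
  ℓ-separated c refl t≢t' ℓt≡ℓt' =
    t≢t' (trans (sym (lookup∘tabulate _ c))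
                (trans (cong (λ L → lookup L c) ℓt≡ℓt') (lookup∘tabulate _ c)))

  module Points (1≤p : 1 ≤ p) (1≤q : 1 ≤ q) (1≤r : 1 ≤ r) where

    private
      <n : ∀ {m} → m ≤ p + q + r → m < n
      <n {m} m≤ = subst (m <_) (+-comm 1 (p + q + r)) (s≤s m≤)

      suc≤+ : ∀ m {k} → 1 ≤ k → suc m ≤ m + k
      suc≤+ m {k} 1≤k = subst (_≤ m + k) (+-comm m 1) (+-monoʳ-≤ m 1≤k)

      p<p+q : p < p + q
      p<p+q = suc≤+ p 1≤q

      o<n : 0 < n
      o<n = <n z≤n
      a<n : 1 < n
      a<n = <n (≤-trans 1≤p (≤-trans (m≤m+n p q) (m≤m+n (p + q) r)))
      b<n : suc p < n
      b<n = <n (≤-trans p<p+q (m≤m+n (p + q) r))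
      c<n : suc (p + q) < n
      c<n = <n (suc≤+ (p + q) 1≤r)

    o a b c : Fin n
    o = fromℕ< o<n
    a = fromℕ< a<n
    b = fromℕ< b<n
    c = fromℕ< c<n

    o-class : classOf (toℕ o) ≡ O
    o-class rewrite toℕ-fromℕ< o<n = refl

    a-class : classOf (toℕ a) ≡ A
    a-class rewrite toℕ-fromℕ< a<n = classOf-A 1≤p

    b-class : classOf (toℕ b) ≡ B
    b-class rewrite toℕ-fromℕ< b<n = classOf-B ≤-refl p<p+q

    c-class : classOf (toℕ c) ≡ C
    c-class rewrite toℕ-fromℕ< c<n = classOf-C ≤-refl

    cmp-a-b : cmp (toℕ a) (toℕ b) ≡ less
    cmp-a-b rewrite toℕ-fromℕ< a<n | toℕ-fromℕ< b<n = <⇒cmp-less (s<s 1≤p)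

    cmp-a-c : cmp (toℕ a) (toℕ c) ≡ less
    cmp-a-c rewrite toℕ-fromℕ< a<n | toℕ-fromℕ< c<n = <⇒cmp-less (s<s (≤-trans 1≤p (m≤m+n p q)))

    cmp-b-c : cmp (toℕ b) (toℕ c) ≡ less
    cmp-b-c rewrite toℕ-fromℕ< b<n | toℕ-fromℕ< c<n = <⇒cmp-less (s<s p<p+q)

    o≢a : o ≢ a
    o≢a o≡a with () ← trans (sym o-class) (trans (cong (classOf ∘ toℕ) o≡a) a-class)

    o≢b : o ≢ b
    o≢b o≡b with () ← trans (sym o-class) (trans (cong (classOf ∘ toℕ) o≡b) b-class)

    o≢c : o ≢ c
    o≢c o≡c with () ← trans (sym o-class) (trans (cong (classOf ∘ toℕ) o≡c) c-class)

    config-abc : configOf (toℕ a) (toℕ b) (toℕ c) ≡ config A B C less less less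
    config-abc = configOf-≡ {toℕ a} {toℕ b} {toℕ c} a-class b-class c-class cmp-a-b cmp-a-c cmp-b-c

FourLines : ∀ {n} → QuasiMetric n → ℕ → ℕ → ℕ → Set
FourLines {n} Q p q r =
  Σ (Subset n) λ ℓ₁ → Σ (Subset n) λ ℓ₂ → Σ (Subset n) λ ℓ₃ → Σ (Subset n) λ ℓ₄ →
    ((ℓ₁ ≢ ℓ₂ × ℓ₁ ≢ ℓ₃ × ℓ₁ ≢ ℓ₄ × ℓ₂ ≢ ℓ₃ × ℓ₂ ≢ ℓ₄ × ℓ₃ ≢ ℓ₄) ×
     (∣ ℓ₁ ∣ + 1 ≡ n × ∣ ℓ₂ ∣ ≡ p + 1 × ∣ ℓ₃ ∣ ≡ q + 1 × ∣ ℓ₄ ∣ ≡ r + 1) ×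
     (IsLine Q ℓ₁ × IsLine Q ℓ₂ × IsLine Q ℓ₃ × IsLine Q ℓ₄) ×
     (∀ ℓ → IsLine Q ℓ → ℓ ≡ ℓ₁ ⊎ ℓ ≡ ℓ₂ ⊎ ℓ ≡ ℓ₃ ⊎ ℓ ≡ ℓ₄))

module Space (p q r : ℕ) (v : Variant) where
  open Construction p q r

  M : ℕ
  M = 3 * n

  levelOf : ℕ → ℕ → ℕ
  levelOf x y = level v (classOf x) (classOf y)

  dirOf : ℕ → ℕ → Direction
  dirOf x y = direction (classOf x) (classOf y) (cmp x y)

  -- ρ(x, y) = dist⁺ x y − dist⁻ x y = δ(x, y) + λ(x, y) · M
  dist⁺ dist⁻ : ℕ → ℕ → ℕ
  dist⁺ x y = δ⁺ (dirOf x y) x y + levelOf x y * M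
  dist⁻ x y = δ⁻ (dirOf x y) x y

  dist⁺-self : ∀ x → dist⁺ x x ≡ x
  dist⁺-self x rewrite level-diag v (classOf x) = trans (+-identityʳ _) (δ⁺-self (dirOf x x) x)

  dist⁻-self : ∀ x → dist⁻ x x ≡ x
  dist⁻-self x = δ⁻-self (dirOf x x) x

  dist⁻<dist⁺ : ∀ {x y} → x < n → y < n → x ≢ y → dist⁻ x y < dist⁺ x y
  dist⁻<dist⁺ {x} {y} x<n y<n x≢y with Equivalence.to T-∨ positive
    where
    positive : T ((0 <ᵇ levelOf x y) ∨ increasing (dirOf x y) (cmp x y))
    positive = ⇒ᵇ-elim (apart (cmp x y))
      (∀⇒-elim pairs pairConsistentᵗ (positiveᵇ v) (positivity-holds v)
        (classOf x , classOf y , cmp x y) (pairConsistent-classOf x y))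
      (Equivalence.from T-≡ (≢⇒apart x≢y))
  ... | inj₁ 0<λ = begin-strict
    dist⁻ x y         <⟨ δ⁻-< (dirOf x y) x<n y<n ⟩
    n                 ≤⟨ m≤m+n n _ ⟩
    M                 ≤⟨ m≤n*m M (levelOf x y) {{>-nonZero (<ᵇ⇒< 0 _ 0<λ)}} ⟩
    levelOf x y * M   ≤⟨ m≤n+m _ _ ⟩
    dist⁺ x y         ∎
    where open ≤-Reasoning
  ... | inj₂ increases = <-≤-trans (δ-increasing (dirOf x y) x y increases) (m≤m+n _ _)

  dist⁻≤dist⁺ : ∀ {x y} → x < n → y < n → dist⁻ x y ≤ dist⁺ x y
  dist⁻≤dist⁺ {x} {y} x<n y<n with x ≟ y
  ... | yes refl = ≤-reflexive (trans (dist⁻-self x) (sym (dist⁺-self x)))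
  ... | no x≢y   = <⇒≤ (dist⁻<dist⁺ x<n y<n x≢y)

  Additive : ℕ → ℕ → ℕ → Set
  Additive x y z = dist⁺ x z + dist⁻ x y + dist⁻ y z ≡ dist⁺ x y + dist⁺ y z + dist⁻ x z

  additive-left : ∀ x z → Additive x x z
  additive-left x z = begin
    dist⁺ x z + dist⁻ x x + dist⁻ x z  ≡⟨ cong (λ w → dist⁺ x z + w + dist⁻ x z) (dist⁻-self x) ⟩
    dist⁺ x z + x + dist⁻ x z          ≡⟨ cong (_+ dist⁻ x z) (+-comm (dist⁺ x z) x) ⟩
    x + dist⁺ x z + dist⁻ x z          ≡⟨ cong (λ w → w + dist⁺ x z + dist⁻ x z) (dist⁺-self x) ⟨
    dist⁺ x x + dist⁺ x z + dist⁻ x z  ∎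
    where open ≡-Reasoning

  additive-right : ∀ x z → Additive x z z
  additive-right x z = begin
    dist⁺ x z + dist⁻ x z + dist⁻ z z  ≡⟨ cong (λ w → dist⁺ x z + dist⁻ x z + w) (dist⁻-self z) ⟩
    dist⁺ x z + dist⁻ x z + z          ≡⟨ +-assoc (dist⁺ x z) _ _ ⟩
    dist⁺ x z + (dist⁻ x z + z)        ≡⟨ cong (λ w → dist⁺ x z + w) (+-comm (dist⁻ x z) z) ⟩
    dist⁺ x z + (z + dist⁻ x z)        ≡⟨ +-assoc (dist⁺ x z) _ _ ⟨
    dist⁺ x z + z + dist⁻ x z          ≡⟨ cong (λ w → dist⁺ x z + w + dist⁻ x z) (dist⁺-self z) ⟨
    dist⁺ x z + dist⁺ z z + dist⁻ x z  ∎
    where open ≡-Reasoning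

  ¬additive-loop : ∀ {x y} → x < n → y < n → x ≢ y → ¬ Additive x y x
  ¬additive-loop {x} {y} x<n y<n x≢y additive = <-irrefl additive (begin-strict
    dist⁺ x x + dist⁻ x y + dist⁻ y x  ≡⟨ cong (λ w → w + dist⁻ x y + dist⁻ y x) (dist⁺-self x) ⟩
    x + dist⁻ x y + dist⁻ y x          ≡⟨ +-assoc x _ _ ⟩
    x + (dist⁻ x y + dist⁻ y x)        <⟨ +-monoʳ-< x (+-mono-< (dist⁻<dist⁺ x<n y<n x≢y)
                                                               (dist⁻<dist⁺ y<n x<n (x≢y ∘ sym))) ⟩
    x + (dist⁺ x y + dist⁺ y x)        ≡⟨ +-comm x _ ⟩
    dist⁺ x y + dist⁺ y x + x          ≡⟨ cong (λ w → dist⁺ x y + dist⁺ y x + w) (dist⁻-self x) ⟨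
    dist⁺ x y + dist⁺ y x + dist⁻ x x  ∎)
    where open ≤-Reasoning

  segment-left : ∀ x z → T (segmentᵇ v (configOf x x z))
  segment-left x z rewrite cmp-self x = tt

  segment-right : ∀ x z → T (segmentᵇ v (configOf x z z))
  segment-right x z rewrite cmp-self z | ∧-zeroʳ (apart (cmp x z)) = tt

  ¬segment-loop : ∀ {x y} → x ≢ y → ¬ T (segmentᵇ v (configOf x y x))
  ¬segment-loop {x} {y} x≢y rewrite ≢⇒apart x≢y | ≢⇒apart (x≢y ∘ sym) | cmp-self x = λ ()

  segment⇔proper : ∀ {x y z} → x ≢ y → y ≢ z → x ≢ z →
    T (segmentᵇ v (configOf x y z)) ⇔ Proper v (configOf x y z)
  segment⇔proper {x} {y} {z} x≢y y≢z x≢z rewrite ≢⇒apart x≢y | ≢⇒apart y≢z | ≢⇒apart x≢z =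
    mk⇔ toWitness (fromWitness {a? = proper? v (configOf x y z)})

  module _ {x y z : ℕ} (x<n : x < n) (y<n : y < n) (z<n : z < n) where

    private
      s₁₂ s₁₃ s₂₃ : Direction
      s₁₂ = dirOf x y
      s₁₃ = dirOf x z
      s₂₃ = dirOf y z

      -- the low digits of both sides of the additivity equation
      low₁ low₂ : ℕ
      low₁ = δ⁺ s₁₃ x z + δ⁻ s₁₂ x y + δ⁻ s₂₃ y z
      low₂ = δ⁺ s₁₂ x y + δ⁺ s₂₃ y z + δ⁻ s₁₃ x z

      sum-< : ∀ {a b c} → a < n → b < n → c < n → a + b + c < M
      sum-< {a} {b} {c} a<n b<n c<n =
        subst (a + b + c <_) (n+n+n≡3n n) (+-mono-< (+-mono-< a<n b<n) c<n)
        where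
        n+n+n≡3n : ∀ n → n + n + n ≡ 3 * n
        n+n+n≡3n = solve-∀

      low₁<M : low₁ < M
      low₁<M = sum-< (δ⁺-< s₁₃ x<n z<n) (δ⁻-< s₁₂ x<n y<n) (δ⁻-< s₂₃ y<n z<n)

      low₂<M : low₂ < M
      low₂<M = sum-< (δ⁺-< s₁₂ x<n y<n) (δ⁺-< s₂₃ y<n z<n) (δ⁻-< s₁₃ x<n z<n)

      lhs-digits : dist⁺ x z + dist⁻ x y + dist⁻ y z ≡ low₁ + levelOf x z * M
      lhs-digits = shuffle (δ⁺ s₁₃ x z) (levelOf x z) M (δ⁻ s₁₂ x y) (δ⁻ s₂₃ y z)
        where
        shuffle : ∀ a l M b c → a + l * M + b + c ≡ a + b + c + l * M
        shuffle = solve-∀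

      triangle : T (triangleᵇ v (configOf x y z))
      triangle = verified-at (triangleᵇ v) (triangle-holds v) x y z

      rhs-digits : dist⁺ x y + dist⁺ y z + dist⁻ x z ≡ low₂ + (levelOf x y + levelOf y z) * M
      rhs-digits = shuffle (δ⁺ s₁₂ x y) (levelOf x y) (δ⁺ s₂₃ y z) (levelOf y z) M (δ⁻ s₁₃ x z)
        where
        shuffle : ∀ a l b l' M c → a + l * M + (b + l' * M) + c ≡ a + b + c + (l + l') * M
        shuffle = solve-∀

    additive⇔proper : x ≢ y → y ≢ z → x ≢ z → Additive x y z ⇔ Proper v (configOf x y z)
    additive⇔proper x≢y y≢z x≢z = mk⇔ to from
      where
      to : Additive x y z → Proper v (configOf x y z)
      to additive = proj₁ digits , δ-additive⇒aligned s₁₃ s₁₂ s₂₃ x≢y y≢z x≢z (proj₂ digits)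
        where digits = +*-injective low₁<M low₂<M (trans (sym lhs-digits) (trans additive rhs-digits))
      from : Proper v (configOf x y z) → Additive x y z
      from (levels , s₁₃≡s₁₂ , s₁₃≡s₂₃) =
        trans lhs-digits (trans (cong₂ (λ l e → e + l * M) levels lows) (sym rhs-digits))
        where
        lows : low₁ ≡ low₂
        lows = subst₂ (λ s s' → δ⁺ s₁₃ x z + δ⁻ s x y + δ⁻ s' y z ≡ δ⁺ s x y + δ⁺ s' y z + δ⁻ s₁₃ x z)
                      s₁₃≡s₁₂ s₁₃≡s₂₃ (δ-additive s₁₃ x y z)

    subadditive : dist⁺ x z + dist⁻ x y + dist⁻ y z ≤ dist⁺ x y + dist⁺ y z + dist⁻ x z
    subadditive with levelOf x z ≟ levelOf x y + levelOf y z
    ... | no levels≢ = subst₂ _≤_ (sym lhs-digits) (sym rhs-digits) (+*-mono-< levels< low₁<M)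
      where
      levels≤ = ∧-elimˡ (levelOf x z ≤ᵇ levelOf x y + levelOf y z) triangle
      levels< = ≤∧≢⇒< (≤ᵇ⇒≤ _ _ levels≤) levels≢
    ... | yes levels = begin
      dist⁺ x z + dist⁻ x y + dist⁻ y z      ≡⟨ lhs-digits ⟩
      low₁ + levelOf x z * M                  ≤⟨ +-monoˡ-≤ _ (δ-triangle _ _ _ x y z δ₁₃≤δ₁₂ δ₁₃≤δ₂₃) ⟩
      low₂ + levelOf x z * M                  ≡⟨ cong (λ l → low₂ + l * M) levels ⟩
      low₂ + (levelOf x y + levelOf y z) * M  ≡⟨ rhs-digits ⟨
      dist⁺ x y + dist⁺ y z + dist⁻ x z      ∎
      where
      open ≤-Reasoning
      dominated = ⇒ᵇ-elim ⌊ levelOf x z ≟ levelOf x y + levelOf y z ⌋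
        (∧-elimʳ (levelOf x z ≤ᵇ levelOf x y + levelOf y z) triangle)
        (fromWitness levels)
      δ₁₃≤δ₁₂ = ∧-elimˡ (δ-≤ᵇ s₁₃ s₁₂ (cmp x y)) dominated
      δ₁₃≤δ₂₃ = ∧-elimʳ (δ-≤ᵇ s₁₃ s₁₂ (cmp x y)) dominated

  additive⇔segment : ∀ {x y z} → x < n → y < n → z < n →
    Additive x y z ⇔ T (segmentᵇ v (configOf x y z))
  additive⇔segment {x} {y} {z} x<n y<n z<n with x ≟ y | y ≟ z | x ≟ z
  ... | yes refl | _        | _        = mk⇔ (λ _ → segment-left x z) (λ _ → additive-left x z)
  ... | no _     | yes refl | _        = mk⇔ (λ _ → segment-right x y) (λ _ → additive-right x y)
  ... | no x≢y   | no _     | yes refl =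
    mk⇔ (⊥-elim ∘ ¬additive-loop x<n y<n x≢y) (⊥-elim ∘ ¬segment-loop x≢y)
  ... | no x≢y   | no y≢z   | no x≢z   =
    ⇔-trans (additive⇔proper x<n y<n z<n x≢y y≢z x≢z) (⇔-sym (segment⇔proper x≢y y≢z x≢z))

  ρ : Fin n → Fin n → ℚ
  ρ a b = ⟦ dist⁺ (toℕ a) (toℕ b) ⊖ dist⁻ (toℕ a) (toℕ b) ⟧

  ρ≡0⇔≡ : ∀ a b → (ρ a b ≡ 0ℚ) ⇔ (a ≡ b)
  ρ≡0⇔≡ a b = ⇔-trans (⟦⊖⟧≡0⇔ _ _) (mk⇔ to from)
    where
    to : dist⁺ (toℕ a) (toℕ b) ≡ dist⁻ (toℕ a) (toℕ b) → a ≡ b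
    to e with toℕ a ≟ toℕ b
    ... | yes a≡b = toℕ-injective a≡b
    ... | no  a≢b = ⊥-elim (<⇒≢ (dist⁻<dist⁺ (toℕ<n a) (toℕ<n b) a≢b) (sym e))
    from : a ≡ b → dist⁺ (toℕ a) (toℕ b) ≡ dist⁻ (toℕ a) (toℕ b)
    from refl = trans (dist⁺-self (toℕ a)) (sym (dist⁻-self (toℕ a)))

  ρ-triangle : ∀ a b c → ρ a b ℚ.≤ ρ a c ℚ.+ ρ c b
  ρ-triangle a b c =
    ⟦⊖⟧-subadditive (dist⁺ x y) (dist⁻ x y) (dist⁺ x z) (dist⁻ x z) (dist⁺ z y) (dist⁻ z y)
      (subadditive (toℕ<n a) (toℕ<n c) (toℕ<n b))
    where
    x = toℕ a
    y = toℕ b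
    z = toℕ c

  space : QuasiMetric n
  space = record
    { ρ        = ρ
    ; nonneg   = λ a b → ⟦⊖⟧-nonneg (dist⁻≤dist⁺ (toℕ<n a) (toℕ<n b))
    ; zero⇔eq  = ρ≡0⇔≡
    ; triangle = ρ-triangle
    }

  configAt : Fin n → Fin n → Fin n → Config
  configAt a b c = configOf (toℕ a) (toℕ b) (toℕ c)

  inSeg⇔ : ∀ a b c → InSeg space a b c ⇔ T (segmentᵇ v (configAt a c b))
  inSeg⇔ a b c = ⇔-trans
    (⟦⊖⟧-additive (dist⁺ x y) (dist⁻ x y) (dist⁺ x z) (dist⁻ x z) (dist⁺ z y) (dist⁻ z y))
    (additive⇔segment (toℕ<n a) (toℕ<n c) (toℕ<n b))
    where
    x = toℕ a
    y = toℕ b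
    z = toℕ c

  onLine⇔ : ∀ a b c → OnLine space a b c ⇔ T (onLineᵇ v (configAt a b c))
  onLine⇔ a b c = ⇔-trans (c∈[ab] ⊎-⇔ a∈[cb] ⊎-⇔ inSeg⇔ a c b) (⇔-sym (⇔-trans T-∨ (⇔-refl ⊎-⇔ T-∨)))
    where
    c∈[ab] : InSeg space c b a ⇔ T (segmentᵇ v (rotate (rotate (configAt a b c))))
    c∈[ab] = subst (λ cf → InSeg space c b a ⇔ T (segmentᵇ v cf))
                   (configOf-rotate² (toℕ a) (toℕ b) (toℕ c)) (inSeg⇔ c b a)
    a∈[cb] : InSeg space a b c ⇔ T (segmentᵇ v (swap₂₃ (configAt a b c)))
    a∈[cb] = subst (λ cf → InSeg space a b c ⇔ T (segmentᵇ v cf))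
                   (configOf-swap (toℕ a) (toℕ b) (toℕ c)) (inSeg⇔ a b c)

  line≡ℓ : ∀ {a b : Fin n} → a ≢ b →
    line space a b ≡ ℓ (lineClass (classOf (toℕ a)) (classOf (toℕ b)) (cmp (toℕ a) (toℕ b)))
  line≡ℓ {a} {b} a≢b = tabulate-cong λ c →
    trans (does-⇔ (onLine⇔ a b c) (onLine? space a b c) (T? _))
          (toWitness (⇒ᵇ-elim (apart (cmp (toℕ a) (toℕ b)))
            (verified-at (lineᵇ v) (lines-hold v) (toℕ a) (toℕ b) (toℕ c))
            (Equivalence.from T-≡ (≢⇒apart (a≢b ∘ toℕ-injective)))))

  isLine⇒ℓ : ∀ {L} → IsLine space L → Σ Class λ t → L ≡ ℓ t
  isLine⇒ℓ (a , b , a≢b , refl) =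
    lineClass (classOf (toℕ a)) (classOf (toℕ b)) (cmp (toℕ a) (toℕ b)) , line≡ℓ a≢b

  ℓ-isLine : ∀ {a b : Fin n} {k k' o} → a ≢ b →
    classOf (toℕ a) ≡ k → classOf (toℕ b) ≡ k' → cmp (toℕ a) (toℕ b) ≡ o →
    IsLine space (ℓ (lineClass k k' o))
  ℓ-isLine {a} {b} a≢b refl refl refl = a , b , a≢b , line≡ℓ a≢b

  fourLines : 1 ≤ p → 1 ≤ q → 1 ≤ r → FourLines space p q r
  fourLines 1≤p 1≤q 1≤r =
    ℓ O , ℓ A , ℓ B , ℓ C ,
    ( ℓ-separated {O} {A} o o-class (λ ()) , ℓ-separated {O} {B} o o-class (λ ())
    , ℓ-separated {O} {C} o o-class (λ ()) , ℓ-separated {A} {B} a a-class (λ ())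
    , ℓ-separated {A} {C} a a-class (λ ()) , ℓ-separated {B} {C} b b-class (λ ()) ) ,
    (∣ℓO∣+1≡n , ∣ℓA∣≡p+1 , ∣ℓB∣≡q+1 , ∣ℓC∣≡r+1) ,
    ( ℓ-isLine {a} {b} (cmp-less⇒≢ {x = a} {b} cmp-a-b) a-class b-class cmp-a-b
    , ℓ-isLine {o} {a} o≢a o-class a-class refl
    , ℓ-isLine {o} {b} o≢b o-class b-class refl
    , ℓ-isLine {o} {c} o≢c o-class c-class refl ) ,
    λ L → one-of-four ∘ isLine⇒ℓ
    where
    open Points 1≤p 1≤q 1≤r
    one-of-four : ∀ {L} → Σ Class (λ t → L ≡ ℓ t) → L ≡ ℓ O ⊎ L ≡ ℓ A ⊎ L ≡ ℓ B ⊎ L ≡ ℓ C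
    one-of-four (O , L≡ℓ) = inj₁ L≡ℓ
    one-of-four (A , L≡ℓ) = inj₂ (inj₁ L≡ℓ)
    one-of-four (B , L≡ℓ) = inj₂ (inj₂ (inj₁ L≡ℓ))
    one-of-four (C , L≡ℓ) = inj₂ (inj₂ (inj₂ L≡ℓ))

  betw⇒segment : ∀ {a b c} → Betw space a b c → T (segmentᵇ v (configAt a b c))
  betw⇒segment {a} {b} {c} (_ , _ , _ , e) = Equivalence.to (inSeg⇔ a c b) (sym e)

  segment⇒betw : ∀ {a b c} → a ≢ b → b ≢ c → a ≢ c → T (segmentᵇ v (configAt a b c)) → Betw space a b c
  segment⇒betw {a} {b} {c} a≢b b≢c a≢c h = a≢b , b≢c , a≢c , sym (Equivalence.from (inSeg⇔ a c b) h)

HasCyclicTriple : ∀ {n} → QuasiMetric n → Set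
HasCyclicTriple {n} Q =
  Σ (Fin n) λ a → Σ (Fin n) λ b → Σ (Fin n) λ c → Betw Q a b c × Betw Q b c a × Betw Q c a b

iso-preserves-cyclic : ∀ {n} {Q P : QuasiMetric n} →
  BetweennessIso Q P → HasCyclicTriple Q → HasCyclicTriple P
iso-preserves-cyclic (φ , preserves) (a , b , c , abc , bca , cab) =
  f a , f b , f c , to (preserves a b c) abc , to (preserves b c a) bca , to (preserves c a b) cab
  where
  f = Bijection.to φ
  open Equivalence using (to)

cyclic-triple : ∀ p q r → 1 ≤ p → 1 ≤ q → 1 ≤ r → HasCyclicTriple (Space.space p q r cyclic)
cyclic-triple p q r 1≤p 1≤q 1≤r =
  a , b , c ,
  segment⇒betw a≢b b≢c a≢c (segment-at config-abc tt) ,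
  segment⇒betw b≢c (a≢c ∘ sym) (a≢b ∘ sym) (segment-at config-bca tt) ,
  segment⇒betw (a≢c ∘ sym) a≢b (b≢c ∘ sym) (segment-at config-cab tt)
  where
  open Construction p q r
  open Points 1≤p 1≤q 1≤r
  open Space p q r cyclic
  x = toℕ a
  y = toℕ b
  z = toℕ c
  a≢b = cmp-less⇒≢ {x = a} {b} cmp-a-b
  b≢c = cmp-less⇒≢ {x = b} {c} cmp-b-c
  a≢c = cmp-less⇒≢ {x = a} {c} cmp-a-c
  config-bca = trans (configOf-rotate x y z) (cong rotate config-abc)
  config-cab = trans (configOf-rotate² x y z) (cong (rotate ∘ rotate) config-abc)
  segment-at : ∀ {cf cf'} → cf ≡ cf' → T (segmentᵇ cyclic cf') → T (segmentᵇ cyclic cf)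
  segment-at refl h = h

no-cyclic-triple : ∀ p q r → ¬ HasCyclicTriple (Space.space p q r acyclic)
no-cyclic-triple p q r (a , b , c , abc@(a≢b , b≢c , a≢c , _) , bca , cab) =
  T-not (cyclicᵇ acyclic cf) not-cyclic is-cyclic
  where
  open Construction p q r
  open Space p q r acyclic
  x = toℕ a
  y = toℕ b
  z = toℕ c
  cf = configOf x y z
  distinct = configOf-distinct (a≢b ∘ toℕ-injective) (a≢c ∘ toℕ-injective) (b≢c ∘ toℕ-injective)
  not-cyclic = ⇒ᵇ-elim (distinctᵇ cf) (verified-at acyclicᵇ acyclic-holds x y z) distinct
  is-cyclic = cyclicᵇ-intro acyclic cf (betw⇒segment abc)
    (subst (T ∘ segmentᵇ acyclic) (configOf-rotate x y z) (betw⇒segment bca))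
    (subst (T ∘ segmentᵇ acyclic) (configOf-rotate² x y z) (betw⇒segment cab))

mainTheorem12 : ∀ n p q r → 4 ≤ n → 1 ≤ p → 1 ≤ q → 1 ≤ r → p + q + r + 1 ≡ n →
    Σ (QuasiMetric n) λ Q₁ → Σ (QuasiMetric n) λ Q₂ →
      ¬ BetweennessIso Q₁ Q₂ ×
      (Σ (Subset n) λ ℓ₁ → Σ (Subset n) λ ℓ₂ → Σ (Subset n) λ ℓ₃ → Σ (Subset n) λ ℓ₄ →
        ((ℓ₁ ≢ ℓ₂ × ℓ₁ ≢ ℓ₃ × ℓ₁ ≢ ℓ₄ × ℓ₂ ≢ ℓ₃ × ℓ₂ ≢ ℓ₄ × ℓ₃ ≢ ℓ₄) ×
         (∣ ℓ₁ ∣ + 1 ≡ n × ∣ ℓ₂ ∣ ≡ p + 1 × ∣ ℓ₃ ∣ ≡ q + 1 × ∣ ℓ₄ ∣ ≡ r + 1) ×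
         (IsLine Q₁ ℓ₁ × IsLine Q₁ ℓ₂ × IsLine Q₁ ℓ₃ × IsLine Q₁ ℓ₄) ×
         (∀ ℓ → IsLine Q₁ ℓ → ℓ ≡ ℓ₁ ⊎ ℓ ≡ ℓ₂ ⊎ ℓ ≡ ℓ₃ ⊎ ℓ ≡ ℓ₄))) ×
      (Σ (Subset n) λ ℓ₁ → Σ (Subset n) λ ℓ₂ → Σ (Subset n) λ ℓ₃ → Σ (Subset n) λ ℓ₄ →
        ((ℓ₁ ≢ ℓ₂ × ℓ₁ ≢ ℓ₃ × ℓ₁ ≢ ℓ₄ × ℓ₂ ≢ ℓ₃ × ℓ₂ ≢ ℓ₄ × ℓ₃ ≢ ℓ₄) ×
         (∣ ℓ₁ ∣ + 1 ≡ n × ∣ ℓ₂ ∣ ≡ p + 1 × ∣ ℓ₃ ∣ ≡ q + 1 × ∣ ℓ₄ ∣ ≡ r + 1) ×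
         (IsLine Q₂ ℓ₁ × IsLine Q₂ ℓ₂ × IsLine Q₂ ℓ₃ × IsLine Q₂ ℓ₄) ×
         (∀ ℓ → IsLine Q₂ ℓ → ℓ ≡ ℓ₁ ⊎ ℓ ≡ ℓ₂ ⊎ ℓ ≡ ℓ₃ ⊎ ℓ ≡ ℓ₄)))
mainTheorem12 .(p + q + r + 1) p q r _ 1≤p 1≤q 1≤r refl =
  Q₁ , Q₂ ,
  (λ iso → no-cyclic-triple p q r (iso-preserves-cyclic {Q = Q₁} {P = Q₂} iso Q₁-cyclic)) ,
  Space.fourLines p q r cyclic 1≤p 1≤q 1≤r ,
  Space.fourLines p q r acyclic 1≤p 1≤q 1≤r
  where
  Q₁ Q₂ : QuasiMetric (p + q + r + 1)
  Q₁ = Space.space p q r cyclic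
  Q₂ = Space.space p q r acyclic
  Q₁-cyclic = cyclic-triple p q r 1≤p 1≤q 1≤r
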